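{- Let $H\in\{3K_1, 2K_2, \text{co-diamond}, \text{co-paw}, 4K_1\}$. If a graph $G$ is $H$-free, then the expanded graph $\tilde{G}$ of $G$ is $H$-free as well.
   Context: All graphs are finite, undirected and simple. The expanded graph $\tilde{G}$ of $G=(V,E)$ is obtained from $G$ by adding a clique $\tilde{K}$ of $|V|^3$ new vertices and making every vertex of $V$ adjacent to all vertices of $\tilde{K}$. A graph is $H$-free if it has no induced subgraph isomorphic to $H$. $sK_1$ is the edgeless graph on $s$ vertices, $2K_2$ is two disjoint edges, co-diamond is an edge plus two isolated vertices, co-paw is a path on three vertices plus an isolated vertex. -}

module Defs where

open import Data.Nat using (ℕ; zero; suc; _+_; _^_)
open import Data.Fin using (Fin; zero; suc; splitAt)
open import Data.Sum using (_⊎_; inj₁; inj₂)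
open import Data.Product using (Σ; _×_; _,_)
open import Data.Bool using (Bool; true; false; T)
open import Data.Unit using (⊤)
open import Data.Empty using (⊥)
open import Relation.Binary.PropositionalEquality using (_≡_)
open import Relation.Nullary using (¬_)
open import Function.Definitions using (Injective)
open import Function.Bundles using (_⇔_)

record Graph : Set₁ where
  field
    n    : ℕ
    Adj  : Fin n → Fin n → Set
    sym  : ∀ {u v} → Adj u v → Adj v u
    irr  : ∀ {v} → ¬ Adj v v
open Graph public

InducedSub : Graph → Graph → Set
InducedSub H G =
  Σ (Fin (n H) → Fin (n G)) λ f →
    Injective _≡_ _≡_ f ×
    (∀ u v → Adj H u v ⇔ Adj G (f u) (f v))

Free : Graph → Graph → Set
Free H G = ¬ InducedSub H G

-- Expanded graph: vertices Fin (n + n^3); the first n are the vertices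
-- of G, the last n^3 form the new clique K̃, joined to everything.

ExpAdj : (G : Graph) → Fin (n G + n G ^ 3) → Fin (n G + n G ^ 3) → Set
ExpAdj G u v with splitAt (n G) u | splitAt (n G) v
... | inj₁ a | inj₁ b = Adj G a b
... | inj₁ a | inj₂ k = ⊤
... | inj₂ k | inj₁ b = ⊤
... | inj₂ k | inj₂ l = ¬ (k ≡ l)

private
  exp-sym : (G : Graph) → ∀ {u v} → ExpAdj G u v → ExpAdj G v u
  exp-sym G {u} {v} p with splitAt (n G) u | splitAt (n G) v
  ... | inj₁ a | inj₁ b = Graph.sym G p
  ... | inj₁ a | inj₂ k = _
  ... | inj₂ k | inj₁ b = _
  ... | inj₂ k | inj₂ l = λ e → p (Relation.Binary.PropositionalEquality.sym e)

  exp-irr : (G : Graph) → ∀ {v} → ¬ ExpAdj G v v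
  exp-irr G {v} p with splitAt (n G) v
  ... | inj₁ a = Graph.irr G p
  ... | inj₂ k = p Relation.Binary.PropositionalEquality.refl

expanded : Graph → Graph
expanded G = record
  { n = n G + n G ^ 3
  ; Adj = ExpAdj G
  ; sym = exp-sym G
  ; irr = exp-irr G
  }

-- Small pattern graphs. An edge table e lists each edge once (as e u v
-- with u < v); adjacency is its symmetric closure.

symClosure : (k : ℕ) (e : Fin k → Fin k → Bool) →
             (∀ v → e v v ≡ false) → Graph
symClosure k e irrE = record
  { n = k
  ; Adj = λ u v → T (e u v) ⊎ T (e v u)
  ; sym = λ { (inj₁ p) → inj₂ p ; (inj₂ p) → inj₁ p }
  ; irr = λ {v} → irrC v
  }
  where
  open import Relation.Binary.PropositionalEquality using (subst)
  irrC : ∀ v → ¬ (T (e v v) ⊎ T (e v v))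
  irrC v (inj₁ p) = subst T (irrE v) p
  irrC v (inj₂ p) = subst T (irrE v) p

open import Relation.Binary.PropositionalEquality using (refl)

noEdges : ∀ {k} → Fin k → Fin k → Bool
noEdges _ _ = false

_K₁ : ℕ → Graph
s K₁ = symClosure s noEdges (λ _ → refl)

e2K2 : Fin 4 → Fin 4 → Bool
e2K2 zero (suc zero) = true
e2K2 (suc (suc zero)) (suc (suc (suc zero))) = true
e2K2 _ _ = false

2K₂ : Graph
2K₂ = symClosure 4 e2K2 λ { zero → refl ; (suc zero) → refl ; (suc (suc zero)) → refl ; (suc (suc (suc zero))) → refl }

eCoDiamond : Fin 4 → Fin 4 → Bool
eCoDiamond zero (suc zero) = true
eCoDiamond _ _ = false

co-diamond : Graph
co-diamond = symClosure 4 eCoDiamond λ { zero → refl ; (suc zero) → refl ; (suc (suc zero)) → refl ; (suc (suc (suc zero))) → refl }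

eCoPaw : Fin 4 → Fin 4 → Bool
eCoPaw zero (suc zero) = true
eCoPaw (suc zero) (suc (suc zero)) = true
eCoPaw _ _ = false

co-paw : Graph
co-paw = symClosure 4 eCoPaw λ { zero → refl ; (suc zero) → refl ; (suc (suc zero)) → refl ; (suc (suc (suc zero))) → refl }

data Forbidden : Graph → Set₁ where
  f3K₁       : Forbidden (3 K₁)
  f2K₂       : Forbidden 2K₂
  fCoDiamond : Forbidden co-diamond
  fCoPaw     : Forbidden co-paw
  f4K₁       : Forbidden (4 K₁)

-- Every vertex of the new clique K̃ is adjacent to all other vertices of
-- the expanded graph, whereas none of the five forbidden graphs has a
-- dominating vertex. An induced embedding reflects dominating vertices,
-- so an induced copy of H in the expanded graph misses K̃ and is therefore
-- an induced copy of H in G itself.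
module Submission where

open import Defs hiding (sym)
open import Data.Nat using (_^_)
open import Data.Fin using (Fin; zero; suc; splitAt; _↑ˡ_; _↑ʳ_)
open import Data.Fin.Properties using (↑ˡ-injective; splitAt-↑ˡ; splitAt-↑ʳ; splitAt⁻¹-↑ˡ; splitAt⁻¹-↑ʳ)
open import Data.Sum using (_⊎_; inj₁; inj₂; reduce)
open import Data.Product using (∃; _,_; proj₁; proj₂)
open import Data.Unit using (tt)
open import Data.Empty using (⊥-elim)
open import Function using (_∘_)
open import Function.Bundles using (_⇔_; Equivalence)
open import Function.Construct.Identity using (⇔-id)
open import Function.Construct.Symmetry using (⇔-sym)
open import Function.Construct.Composition using (_⇔-∘_)
open import Relation.Binary.PropositionalEquality using (_≡_; sym; trans; cong; subst; subst₂)
open import Relation.Nullary using (¬_)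

Dominating : (G : Graph) → Fin (n G) → Set
Dominating G v = ∀ w → ¬ v ≡ w → Adj G v w

NoDominatingVertex : Graph → Set
NoDominatingVertex G = ∀ v → ¬ Dominating G v

-- A non-edge of a pattern graph has adjacency T false ⊎ T false, i.e. ⊥ ⊎ ⊥.
forbidden⇒noDominatingVertex : ∀ {H} → Forbidden H → NoDominatingVertex H
forbidden⇒noDominatingVertex f3K₁ zero                         dominating = reduce (dominating (suc zero) λ ())
forbidden⇒noDominatingVertex f3K₁ (suc v)                      dominating = reduce (dominating zero λ ())
forbidden⇒noDominatingVertex f4K₁ zero                         dominating = reduce (dominating (suc zero) λ ())
forbidden⇒noDominatingVertex f4K₁ (suc v)                      dominating = reduce (dominating zero λ ())
forbidden⇒noDominatingVertex f2K₂ zero                         dominating = reduce (dominating (suc (suc zero)) λ ())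
forbidden⇒noDominatingVertex f2K₂ (suc zero)                   dominating = reduce (dominating (suc (suc zero)) λ ())
forbidden⇒noDominatingVertex f2K₂ (suc (suc zero))             dominating = reduce (dominating zero λ ())
forbidden⇒noDominatingVertex f2K₂ (suc (suc (suc zero)))       dominating = reduce (dominating zero λ ())
forbidden⇒noDominatingVertex fCoDiamond zero                   dominating = reduce (dominating (suc (suc zero)) λ ())
forbidden⇒noDominatingVertex fCoDiamond (suc zero)             dominating = reduce (dominating (suc (suc zero)) λ ())
forbidden⇒noDominatingVertex fCoDiamond (suc (suc zero))       dominating = reduce (dominating (suc (suc (suc zero))) λ ())
forbidden⇒noDominatingVertex fCoDiamond (suc (suc (suc zero))) dominating = reduce (dominating (suc (suc zero)) λ ())
forbidden⇒noDominatingVertex fCoPaw zero                       dominating = reduce (dominating (suc (suc zero)) λ ())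
forbidden⇒noDominatingVertex fCoPaw (suc zero)                 dominating = reduce (dominating (suc (suc (suc zero))) λ ())
forbidden⇒noDominatingVertex fCoPaw (suc (suc zero))           dominating = reduce (dominating zero λ ())
forbidden⇒noDominatingVertex fCoPaw (suc (suc (suc zero)))     dominating = reduce (dominating zero λ ())

InducedSub-reflects-dominating : ∀ {H G} (φ : InducedSub H G) u →
                                 Dominating G (proj₁ φ u) → Dominating H u
InducedSub-reflects-dominating (f , f-inj , f-iso) u dominating w u≢w =
  Equivalence.from (f-iso u w) (dominating (f w) (u≢w ∘ f-inj))

InducedSub-restrict : ∀ {H G G′} (ι : InducedSub G G′) (φ : InducedSub H G′) →
                      (∀ u → ∃ λ a → proj₁ ι a ≡ proj₁ φ u) → InducedSub H G
InducedSub-restrict {H} {G} {G′} (ι , ι-inj , ι-iso) (f , f-inj , f-iso) lift = g , g-inj , g-iso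
  where
  g : Fin (n H) → Fin (n G)
  g u = proj₁ (lift u)

  ι∘g≡f : ∀ u → ι (g u) ≡ f u
  ι∘g≡f u = proj₂ (lift u)

  g-inj : ∀ {u v} → g u ≡ g v → u ≡ v
  g-inj {u} {v} eq = f-inj (trans (sym (ι∘g≡f u)) (trans (cong ι eq) (ι∘g≡f v)))

  g-iso : ∀ u v → Adj H u v ⇔ Adj G (g u) (g v)
  g-iso u v = ⇔-sym (ι-iso (g u) (g v))
          ⇔-∘ subst₂ (λ x y → Adj H u v ⇔ Adj G′ x y) (sym (ι∘g≡f u)) (sym (ι∘g≡f v)) (f-iso u v)

module _ (G : Graph) where
  private
    N = n G
    M = n G ^ 3

  expanded-vertex : ∀ x → (∃ λ a → a ↑ˡ M ≡ x) ⊎ (∃ λ k → N ↑ʳ k ≡ x)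
  expanded-vertex x with splitAt N x in eq
  ... | inj₁ a = inj₁ (a , splitAt⁻¹-↑ˡ eq)
  ... | inj₂ k = inj₂ (k , splitAt⁻¹-↑ʳ eq)

  ExpAdj-↑ˡ : ∀ a b → Adj G a b ⇔ ExpAdj G (a ↑ˡ M) (b ↑ˡ M)
  ExpAdj-↑ˡ a b rewrite splitAt-↑ˡ N a M | splitAt-↑ˡ N b M = ⇔-id _

  InducedSub-expanded : InducedSub G (expanded G)
  InducedSub-expanded = (_↑ˡ M) , ↑ˡ-injective M _ _ , ExpAdj-↑ˡ

  clique-dominating : ∀ k → Dominating (expanded G) (N ↑ʳ k)
  clique-dominating k y k≢y rewrite splitAt-↑ʳ N M k with splitAt N y in eq
  ... | inj₁ _ = tt
  ... | inj₂ l = λ k≡l → k≢y (trans (cong (N ↑ʳ_) k≡l) (splitAt⁻¹-↑ʳ eq))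

  InducedSub-avoids-clique : ∀ H → NoDominatingVertex H → (φ : InducedSub H (expanded G)) →
                             ∀ u → ∃ λ a → a ↑ˡ M ≡ proj₁ φ u
  InducedSub-avoids-clique H noDominating φ u with expanded-vertex (proj₁ φ u)
  ... | inj₁ lift = lift
  ... | inj₂ (k , eq) = ⊥-elim (noDominating u (InducedSub-reflects-dominating {H} {expanded G} φ u
                          (subst (Dominating (expanded G)) eq (clique-dominating k))))

lemma3 : (H : Graph) → Forbidden H → (G : Graph) → Free H G → Free H (expanded G)
lemma3 H forbidden G H-free φ =
  H-free (InducedSub-restrict {H} {G} {expanded G} (InducedSub-expanded G) φ
           (InducedSub-avoids-clique G H (forbidden⇒noDominatingVertex forbidden) φ))
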